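{- Let $k\ge 2$, $a$, $b$ be positive integers, let $M$ be a strongly $k$-chromatic-choosable graph with $V(M)=\{v_1,\dots,v_n\}$, and let $H = M\square K_{a,b}$, where $K_{a,b}$ has partite sets $X=\{x_1,\dots,x_a\}$ and $Y=\{y_1,\dots,y_b\}$. Let $L$ be a $(k+a-1)$-assignment for $H$ such that, for each $i\in[n]$, the lists $L(v_i,x_1),\dots,L(v_i,x_a)$ are pairwise disjoint. Let $\mathcal{C}_X$ be the set of all proper $L_X$-colorings of $H_X$ and $\mathcal{I}_X\subseteq\mathcal{C}_X$ the set of $(n-1)$-to-1 colorings in $\mathcal{C}_X$. If \[ b < |\mathcal{I}_X| + \frac{|\mathcal{C}_X| - |\mathcal{I}_X|}{2^{k-1}}, \] then $H$ has a proper $L$-coloring.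
   Context: The Cartesian product $G \square H$ has vertex set $V(G)\times V(H)$, with $(u,v)$ adjacent to $(u',v')$ iff either $u=u'$ and $vv'\in E(H)$, or $v=v'$ and $uu'\in E(G)$. A $k$-assignment assigns each vertex a list of $k$ colors; a proper $L$-coloring is a proper coloring choosing each vertex's color from its list. A graph is $k$-vertex critical if its chromatic number is $k$ and deleting any vertex decreases the chromatic number; $G$ is strongly $k$-chromatic-choosable if it is $k$-vertex critical and every $(k-1)$-assignment $L$ for which $G$ has no proper $L$-coloring assigns the same list to all vertices. $H_X$ is the subgraph of $H$ induced by $\{(v_i,x_j): i\in[n], j\in[a]\}$ and $L_X$ is the restriction of $L$ to $V(H_X)$. A coloring $f$ is $(n-1)$-to-1 if every color $q$ in its range satisfies $|f^{ -1}(q)|\le n-1$. -}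

module Defs where

open import Data.Nat using (ℕ; zero; suc; _+_; _∸_; _≤_; _≤?_)
import Data.Nat as ℕ
open import Data.Fin using (Fin; zero; suc)
import Data.Fin as Fin
open import Data.Fin.Properties using (all?)
open import Data.Bool using (Bool; true; false; _∧_; _∨_; if_then_else_)
import Data.Bool as B
open import Data.Sum using (_⊎_; inj₁; inj₂)
import Data.Sum.Properties as SumP
open import Data.Product using (Σ; ∃; _×_; _,_; proj₁; proj₂)
open import Data.List using (List; []; _∷_; length; filter; concatMap; map)
open import Data.List.Relation.Unary.Unique.Propositional using (Unique)
open import Data.List.Membership.Propositional using (_∈_; _∉_)
open import Data.Vec using (Vec; []; _∷_; lookup)
open import Relation.Nullary using (¬_; Dec; yes; no)
open import Relation.Nullary.Decidable using (⌊_⌋; map′; _→-dec_; ¬?)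
open import Relation.Binary.Definitions using (DecidableEquality)
open import Relation.Binary.PropositionalEquality using (_≡_; _≢_; refl)

Adjacency : Set → Set
Adjacency V = V → V → Bool

record Graph (n : ℕ) : Set where
  field
    adj        : Adjacency (Fin n)
    adj-sym    : ∀ u v → adj u v ≡ adj v u
    adj-irrefl : ∀ v → adj v v ≡ false
open Graph public

Proper : {V C : Set} → Adjacency V → (V → C) → Set
Proper adj f = ∀ u v → adj u v ≡ true → f u ≢ f v

Colorable : {V : Set} → Adjacency V → ℕ → Set
Colorable {V} adj m = Σ (V → Fin m) (Proper adj)

ChromaticNumber : {V : Set} → Adjacency V → ℕ → Set
ChromaticNumber adj k = Colorable adj k × ¬ Colorable adj (k ∸ 1)

deleteVertex : {V : Set} → Adjacency V → (v : V) → Adjacency (Σ V (λ u → u ≢ v))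
deleteVertex adj v (u , _) (w , _) = adj u w

VertexCritical : {V : Set} → Adjacency V → ℕ → Set
VertexCritical {V} adj k =
  ChromaticNumber adj k × (∀ (v : V) → Colorable (deleteVertex adj v) (k ∸ 1))

IsAssignment : {V : Set} → (V → List ℕ) → ℕ → Set
IsAssignment {V} L m = ∀ (v : V) → length (L v) ≡ m × Unique (L v)

LColoring : {V : Set} → Adjacency V → (V → List ℕ) → Set
LColoring {V} adj L = Σ (V → ℕ) (λ f → (∀ v → f v ∈ L v) × Proper adj f)

SameList : List ℕ → List ℕ → Set
SameList l l' = ∀ c → (c ∈ l → c ∈ l') × (c ∈ l' → c ∈ l)

StronglyChromaticChoosable : {n : ℕ} → Graph n → ℕ → Set
StronglyChromaticChoosable G k =
  VertexCritical (adj G) k ×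
  (∀ L → IsAssignment L (k ∸ 1) → ¬ LColoring (adj G) L →
     ∀ u v → SameList (L u) (L v))

-- K_{a,b} with partite sets X = Fin a (inj₁) and Y = Fin b (inj₂).

KAdj : (a b : ℕ) → Adjacency (Fin a ⊎ Fin b)
KAdj a b (inj₁ _) (inj₂ _) = true
KAdj a b (inj₂ _) (inj₁ _) = true
KAdj a b (inj₁ _) (inj₁ _) = false
KAdj a b (inj₂ _) (inj₂ _) = false

cartAdj : {V W : Set} → DecidableEquality V → DecidableEquality W →
          Adjacency V → Adjacency W → Adjacency (V × W)
cartAdj _≟V_ _≟W_ adjG adjH (u , v) (u' , v') =
  (⌊ u ≟V u' ⌋ ∧ adjH v v') ∨ (⌊ v ≟W v' ⌋ ∧ adjG u u')

HAdj : {n : ℕ} → Graph n → (a b : ℕ) → Adjacency (Fin n × (Fin a ⊎ Fin b))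
HAdj M a b = cartAdj Fin._≟_ (SumP.≡-dec Fin._≟_ Fin._≟_) (adj M) (KAdj a b)

HXAdj : {n : ℕ} → Graph n → (a b : ℕ) → Adjacency (Fin n × Fin a)
HXAdj M a b (i , j) (i' , j') = HAdj M a b (i , inj₁ j) (i' , inj₁ j')

LX : {n a b : ℕ} → (Fin n × (Fin a ⊎ Fin b) → List ℕ) → (Fin n × Fin a → List ℕ)
LX L (i , j) = L (i , inj₁ j)

-- Enumeration of all L_X-colourings (proper or not) of H_X.
-- A colouring of H_X is stored as a table g with g[i][j] the colour of (v_i,x_j).

choices : {A : Set} (m : ℕ) → (Fin m → List A) → List (Vec A m)
choices zero    f = [] ∷ []
choices (suc m) f = concatMap (λ x → map (x ∷_) (choices m (λ i → f (suc i)))) (f zero)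

asFun : {n a : ℕ} → Vec (Vec ℕ a) n → (Fin n × Fin a → ℕ)
asFun g (i , j) = lookup (lookup g i) j

allLXColorings : (n a : ℕ) → (Fin n × Fin a → List ℕ) → List (Vec (Vec ℕ a) n)
allLXColorings n a L = choices n (λ i → choices a (λ j → L (i , j)))

sumFin : {m : ℕ} → (Fin m → ℕ) → ℕ
sumFin {zero}  f = 0
sumFin {suc m} f = f zero + sumFin (λ i → f (suc i))

fiberSize : {n a : ℕ} → (Fin n × Fin a → ℕ) → ℕ → ℕ
fiberSize f q = sumFin (λ i → sumFin (λ j → if ⌊ f (i , j) ℕ.≟ q ⌋ then 1 else 0))

ToOne : {n a : ℕ} → (Fin n × Fin a → ℕ) → Set
ToOne {n} {a} f = ∀ q → (∃ λ v → f v ≡ q) → fiberSize f q ≤ n ∸ 1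

proper? : {n a : ℕ} (adj : Adjacency (Fin n × Fin a)) (f : Fin n × Fin a → ℕ) →
          Dec (Proper adj f)
proper? adj f =
  map′ (λ h → λ { (i , j) (i' , j') → h i j i' j' })
       (λ h i j i' j' → h (i , j) (i' , j'))
       (all? λ i → all? λ j → all? λ i' → all? λ j' →
          (adj (i , j) (i' , j') B.≟ true) →-dec ¬? (f (i , j) ℕ.≟ f (i' , j')))

toOne? : {n a : ℕ} (f : Fin n × Fin a → ℕ) → Dec (ToOne {n} {a} f)
toOne? {n} f =
  map′ (λ h → λ { q ((i , j) , refl) → h i j })
       (λ h i j → h (f (i , j)) ((i , j) , refl))
       (all? λ i → all? λ j → fiberSize f (f (i , j)) ≤? n ∸ 1)

CX : {n : ℕ} → Graph n → (a b : ℕ) → (Fin n × (Fin a ⊎ Fin b) → List ℕ) →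
     List (Vec (Vec ℕ a) n)
CX {n} M a b L =
  filter (λ g → proper? (HXAdj M a b) (asFun g)) (allLXColorings n a (LX {n} {a} {b} L))

IX : {n : ℕ} → Graph n → (a b : ℕ) → (Fin n × (Fin a ⊎ Fin b) → List ℕ) →
     List (Vec (Vec ℕ a) n)
IX {n} M a b L = filter (λ g → toOne? {n} {a} (asFun g)) (CX M a b L)

{-# OPTIONS --safe #-}
module Submission where

-- Suppose H has no proper L-colouring. Fix a proper L_X-colouring F of H_X and a vertex y_l
-- of Y. Extending F to the copy of M at y_l means colouring M from the lists L(v_i, y_l) minus
-- the colours F uses on row i, which have at least k - 1 entries. So every F is blocked by
-- some y_l, and strong chromatic-choosability then forces these residual lists to be one
-- (k - 1)-set S, with L(v_i, y_l) the disjoint union of row i of F and S for every i. Hence,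
-- among the colourings blocked by y_l,
--   * each is determined by S, so by its first row, whose entries are taken from disjoint
--     subsets of L(v_1, y_l); there are at most 2^(k-1) of them;
--   * an (n-1)-to-1 colouring is the only one, since a colour in the S of another one but not
--     in its own S would occur in each of its n rows.
-- Weighting the (n-1)-to-1 colourings by 2^(k-1) and the others by 1, the weight of 𝒞_X is
-- thus at most b 2^(k-1), contradicting the hypothesis.

open import Defs
open import Data.Nat using (ℕ; _+_; _*_; _∸_; _^_; _≤_; _<_)
open import Data.Fin using (Fin)
open import Data.Sum using (_⊎_; inj₁)
open import Data.Product using (_×_; _,_)
open import Data.List using (List; length)
open import Data.List.Membership.Propositional using (_∈_; _∉_)
open import Relation.Binary.PropositionalEquality using (_≢_)

open import Data.Bool using (true; false; _∧_; if_then_else_)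
import Data.Bool as Bool
open import Data.Bool.Properties using (T-≡; T-∧; T-∨)
open import Data.Empty using (⊥-elim)
open import Data.Fin using (zero; suc)
open import Data.Fin.Properties using (all?; ¬∀⟶∃¬)
import Data.Fin.Properties as Fin
open import Data.List
  using ([]; _∷_; _++_; filter; map; concatMap; take; tabulate; cartesianProductWith)
open import Data.List.Properties
  using ( length-++; length-filter; length-++-sucʳ; length-map; length-take; length-tabulate
        ; tabulate-cong)
open import Data.List.Membership.Propositional using (find; lose)
open import Data.List.Membership.Propositional.Properties
  using (∈-∃++; ∈-++⁻; ∈-++⁺ˡ; ∈-++⁺ʳ; ∈-map⁻; ∈-filter⁺; ∈-filter⁻; ∈-tabulate⁺; ∈-tabulate⁻;
         ∈-cartesianProductWith⁺; ∈-cartesianProductWith⁻)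
open import Data.List.Relation.Binary.Disjoint.Propositional using (Disjoint)
open import Data.List.Relation.Binary.Subset.Propositional using (_⊆_)
import Data.List.Relation.Binary.Sublist.Propositional.Properties as Sublist
open import Data.List.Relation.Unary.Any using (here; there; any?)
import Data.List.Relation.Unary.All as All
open import Data.List.Relation.Unary.AllPairs using (_∷_)
import Data.List.Relation.Unary.AllPairs as AllPairs
open import Data.List.Relation.Unary.Unique.Propositional using (Unique; [])
import Data.List.Relation.Unary.Unique.Propositional.Properties as Unique
open import Data.Nat using (zero; suc; z≤n; s≤s)
import Data.Nat as ℕ
import Data.Vec
open import Data.Nat.ListAction using (sum)
open import Data.Nat.Properties
open import Data.Nat.Tactic.RingSolver using (solve-∀)
open import Data.Product using (∃; proj₁; proj₂)
open import Data.Sum using (inj₂)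
import Data.Sum.Properties as Sum
open import Data.Vec using (Vec; []; _∷_; lookup)
import Data.Vec.Properties as Vec
open import Data.Vec.Functional using (Vector; updateAt)
open import Data.Vec.Functional.Properties using (updateAt-updates; updateAt-minimal)
open import Function using (_∘_; const; Equivalence)
open import Level using (0ℓ)
open import Relation.Binary.Definitions using (DecidableEquality)
open import Relation.Binary.PropositionalEquality
  using (_≡_; _≗_; refl; sym; trans; cong; cong₂; subst; subst₂; module ≡-Reasoning)
open import Relation.Nullary using (¬_; Dec; yes; no; does; ¬?; _→-dec_; contradiction)
open import Relation.Nullary.Decidable using (⌊_⌋; toWitness; dec-true; dec-false)
open import Relation.Unary using (Pred; Decidable)
open import Relation.Unary.Properties using (∁?)

private
  variable
    A B : Set

⊆⇒length≤ : {xs ys : List A} → Unique xs → xs ⊆ ys → length xs ≤ length ys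
⊆⇒length≤ {xs = []} _ _ = z≤n
⊆⇒length≤ {xs = x ∷ xs} {ys} (x∉xs ∷ xs!) xs⊆ys with ∈-∃++ (xs⊆ys (here refl))
... | us , vs , refl =
  ≤-trans (s≤s (⊆⇒length≤ xs! xs⊆us++vs)) (≤-reflexive (sym (length-++-sucʳ us x vs)))
  where
  xs⊆us++vs : xs ⊆ us ++ vs
  xs⊆us++vs {y} y∈xs with ∈-++⁻ us (xs⊆ys (there y∈xs))
  ... | inj₁ p = ∈-++⁺ˡ p
  ... | inj₂ (here refl) = ⊥-elim (All.lookup x∉xs y∈xs refl)
  ... | inj₂ (there p) = ∈-++⁺ʳ us p

injectiveOn⇒length≤ : (f : A → B) {xs : List A} {ys : List B} → Unique xs →
  (∀ {x} → x ∈ xs → f x ∈ ys) → (∀ {x y} → x ∈ xs → y ∈ xs → f x ≡ f y → x ≡ y) →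
  length xs ≤ length ys
injectiveOn⇒length≤ f {xs} {ys} xs! f∈ys f-inj = begin
  length xs         ≡⟨ length-map f xs ⟨
  length (map f xs) ≤⟨ ⊆⇒length≤ (map-unique xs! f-inj) map⊆ys ⟩
  length ys         ∎
  where
  open ≤-Reasoning
  map-unique : ∀ {xs} → Unique xs → (∀ {x y} → x ∈ xs → y ∈ xs → f x ≡ f y → x ≡ y) →
               Unique (map f xs)
  map-unique [] _ = []
  map-unique {x ∷ xs} (x∉xs ∷ xs!) inj =
    All.tabulate fx∉ ∷ map-unique xs! (λ p q → inj (there p) (there q))
    where
    fx∉ : ∀ {z} → z ∈ map f xs → f x ≢ z
    fx∉ z∈ fx≡z with ∈-map⁻ f z∈
    ... | y , y∈xs , refl = All.lookup x∉xs y∈xs (inj (here refl) (there y∈xs) fx≡z)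
  map⊆ys : map f xs ⊆ ys
  map⊆ys z∈ with ∈-map⁻ f z∈
  ... | x , x∈xs , refl = f∈ys x∈xs

length-filter-∁ : {P : Pred A 0ℓ} (P? : Decidable P) (xs : List A) →
                  length (filter P? xs) + length (filter (∁? P?) xs) ≡ length xs
length-filter-∁ P? [] = refl
length-filter-∁ P? (x ∷ xs) with P? x
... | yes _ = cong suc (length-filter-∁ P? xs)
... | no _ = trans (+-suc _ _) (cong suc (length-filter-∁ P? xs))

length-cartesianProductWith : {C : Set} (f : A → B → C) (xs : List A) (ys : List B) →
  length (cartesianProductWith f xs ys) ≡ length xs * length ys
length-cartesianProductWith f [] ys = refl
length-cartesianProductWith f (x ∷ xs) ys = begin
  length (map (f x) ys ++ cartesianProductWith f xs ys)   ≡⟨ length-++ (map (f x) ys) ⟩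
  length (map (f x) ys) + length (cartesianProductWith f xs ys)
    ≡⟨ cong₂ _+_ (length-map (f x) ys) (length-cartesianProductWith f xs ys) ⟩
  length ys + length xs * length ys                       ∎
  where open ≡-Reasoning

choices-suc : {A : Set} (m : ℕ) (S : Fin (suc m) → List A) →
  choices (suc m) S ≡ cartesianProductWith _∷_ (S zero) (choices m (S ∘ suc))
choices-suc {A} m S = concatMap≡cartesianProductWith (S zero)
  where
  concatMap≡cartesianProductWith : (xs : List A) →
    concatMap (λ x → map (x ∷_) (choices m (S ∘ suc))) xs
      ≡ cartesianProductWith _∷_ xs (choices m (S ∘ suc))
  concatMap≡cartesianProductWith [] = refl
  concatMap≡cartesianProductWith (x ∷ xs) = cong (_ ++_) (concatMap≡cartesianProductWith xs)

∈-choices⁻ : (m : ℕ) (S : Fin m → List A) {v : Vec A m} → v ∈ choices m S → ∀ j → lookup v j ∈ S j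
∈-choices⁻ (suc m) S v∈ j
  with ∈-cartesianProductWith⁻ _∷_ (S zero) (choices m (S ∘ suc))
         (subst (_ ∈_) (choices-suc m S) v∈)
∈-choices⁻ (suc m) S v∈ zero    | x , w , x∈ , w∈ , refl = x∈
∈-choices⁻ (suc m) S v∈ (suc j) | x , w , x∈ , w∈ , refl = ∈-choices⁻ m (S ∘ suc) w∈ j

∈-choices⁺ : (m : ℕ) (S : Fin m → List A) (v : Vec A m) → (∀ j → lookup v j ∈ S j) → v ∈ choices m S
∈-choices⁺ zero S [] _ = here refl
∈-choices⁺ (suc m) S (x ∷ v) v∈S = subst (_ ∈_) (sym (choices-suc m S))
  (∈-cartesianProductWith⁺ _∷_ (v∈S zero) (∈-choices⁺ m (S ∘ suc) v (v∈S ∘ suc)))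

choices-unique : (m : ℕ) (S : Fin m → List A) → (∀ j → Unique (S j)) → Unique (choices m S)
choices-unique zero S _ = All.[] ∷ []
choices-unique (suc m) S S! = subst Unique (sym (choices-suc m S))
  (Unique.cartesianProductWith⁺ _∷_ Vec.∷-injective (S! zero)
    (choices-unique m (S ∘ suc) (S! ∘ suc)))

2*n≤2^n : ∀ n → 2 * n ≤ 2 ^ n
2*n≤2^n zero = z≤n
2*n≤2^n (suc zero) = ≤-refl
2*n≤2^n (suc (suc n)) = begin
  2 * suc (suc n)          ≡⟨ *-suc 2 (suc n) ⟩
  2 + 2 * suc n            ≤⟨ +-mono-≤ (*-monoʳ-≤ 2 (m^n>0 2 n)) (2*n≤2^n (suc n)) ⟩
  2 ^ suc n + 2 ^ suc n    ≡⟨ cong (2 ^ suc n +_) (+-identityʳ (2 ^ suc n)) ⟨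
  2 ^ suc (suc n)          ∎
  where open ≤-Reasoning

module _ {A : Set} (_≟_ : DecidableEquality A) where
  open import Data.List.Membership.DecPropositional _≟_ using (_∈?_; _∉?_)

  length-filter-∈≤ : {xs : List A} (ys : List A) → Unique xs →
                     length (filter (_∈? ys) xs) ≤ length ys
  length-filter-∈≤ {xs} ys xs! =
    ⊆⇒length≤ (Unique.filter⁺ (_∈? ys) xs!) (proj₂ ∘ ∈-filter⁻ (_∈? ys) {xs = xs})

  length-filter-∈< : {xs ys : List A} {y : A} → Unique xs → y ∈ ys → y ∉ xs →
                     length (filter (_∈? ys) xs) < length ys
  length-filter-∈< {xs} {ys} xs! y∈ys y∉xs =
    ⊆⇒length≤ (All.tabulate y≢ ∷ Unique.filter⁺ (_∈? ys) xs!) y∷filter⊆ys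
    where
    y≢ : ∀ {z} → z ∈ filter (_∈? ys) xs → _ ≢ z
    y≢ z∈ refl = y∉xs (proj₁ (∈-filter⁻ (_∈? ys) {xs = xs} z∈))
    y∷filter⊆ys : _ ∷ filter (_∈? ys) xs ⊆ ys
    y∷filter⊆ys (here refl) = y∈ys
    y∷filter⊆ys (there z∈) = proj₂ (∈-filter⁻ (_∈? ys) {xs = xs} z∈)

  -- Each factor satisfies |S j| ≤ 2 ^ (|S j| ∸ 1), and the S j use up disjoint parts of ys.
  length-choices-disjoint : (m : ℕ) (S : Fin m → List A) (ys : List A) →
    (∀ j → Unique (S j)) → (∀ j → S j ⊆ ys) → (∀ {j j′} → j ≢ j′ → Disjoint (S j) (S j′)) →
    length (choices m S) * 2 ^ m ≤ 2 ^ length ys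
  length-choices-disjoint zero S ys _ _ _ = m^n>0 2 (length ys)
  length-choices-disjoint (suc m) S ys S! S⊆ys S-disjoint = begin
    length (choices (suc m) S) * 2 ^ suc m
      ≡⟨ cong (_* 2 ^ suc m) (trans (cong length (choices-suc m S))
                                      (length-cartesianProductWith _∷_ (S zero) _)) ⟩
    length (S zero) * count * (2 * 2 ^ m)   ≡⟨ regroup (length (S zero)) count (2 ^ m) ⟩
    2 * length (S zero) * (count * 2 ^ m)
      ≤⟨ *-mono-≤ (2*n≤2^n (length (S zero)))
                  (length-choices-disjoint m (S ∘ suc) rest (S! ∘ suc) S∘suc⊆rest
                                           (S-disjoint ∘ (_∘ Fin.suc-injective))) ⟩
    2 ^ length (S zero) * 2 ^ length rest   ≡⟨ ^-distribˡ-+-* 2 (length (S zero)) (length rest) ⟨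
    2 ^ (length (S zero) + length rest)     ≤⟨ ^-monoʳ-≤ 2 S₀+rest≤ys ⟩
    2 ^ length ys                           ∎
    where
    open ≤-Reasoning
    count : ℕ
    count = length (choices m (S ∘ suc))
    rest : List A
    rest = filter (_∉? S zero) ys
    regroup : ∀ x c t → x * c * (2 * t) ≡ 2 * x * (c * t)
    regroup = solve-∀
    S∘suc⊆rest : ∀ j → S (suc j) ⊆ rest
    S∘suc⊆rest j c∈ =
      ∈-filter⁺ (_∉? S zero) (S⊆ys (suc j) c∈) (λ c∈S₀ → S-disjoint (λ ()) (c∈S₀ , c∈))
    S₀+rest≤ys : length (S zero) + length rest ≤ length ys
    S₀+rest≤ys = begin
      length (S zero) + length rest                   ≤⟨ +-monoˡ-≤ _ (⊆⇒length≤ (S! zero) S₀⊆) ⟩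
      length (filter (_∈? S zero) ys) + length rest   ≡⟨ length-filter-∁ (_∈? S zero) ys ⟩
      length ys                                       ∎
      where
      S₀⊆ : S zero ⊆ filter (_∈? S zero) ys
      S₀⊆ c∈ = ∈-filter⁺ (_∈? S zero) (S⊆ys zero c∈) c∈

≤-sumFin : ∀ {m} (g : Fin m → ℕ) j → g j ≤ sumFin g
≤-sumFin g zero = m≤m+n _ _
≤-sumFin g (suc j) = ≤-trans (≤-sumFin (g ∘ suc) j) (m≤n+m _ (g zero))

*-≤-sumFin : ∀ {m} (g : Fin m → ℕ) {c} → (∀ l → c ≤ g l) → m * c ≤ sumFin g
*-≤-sumFin {zero} g c≤g = z≤n
*-≤-sumFin {suc m} g c≤g = +-mono-≤ (c≤g zero) (*-≤-sumFin (g ∘ suc) (c≤g ∘ suc))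

sumFin-≤-* : ∀ {m} (g : Fin m → ℕ) {c} → (∀ l → g l ≤ c) → sumFin g ≤ m * c
sumFin-≤-* {zero} g g≤c = z≤n
sumFin-≤-* {suc m} g g≤c = +-mono-≤ (g≤c zero) (sumFin-≤-* (g ∘ suc) (g≤c ∘ suc))

sumFin-cong : ∀ {m} {g h : Fin m → ℕ} → g ≗ h → sumFin g ≡ sumFin h
sumFin-cong {zero} g≗h = refl
sumFin-cong {suc m} g≗h = cong₂ _+_ (g≗h zero) (sumFin-cong (g≗h ∘ suc))

sumFin-+ : ∀ {m} (g h : Fin m → ℕ) → sumFin (λ l → g l + h l) ≡ sumFin g + sumFin h
sumFin-+ {zero} g h = refl
sumFin-+ {suc m} g h = begin
  g zero + h zero + sumFin (λ l → g (suc l) + h (suc l))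
    ≡⟨ cong (g zero + h zero +_) (sumFin-+ (g ∘ suc) (h ∘ suc)) ⟩
  g zero + h zero + (sumFin (g ∘ suc) + sumFin (h ∘ suc))
    ≡⟨ +-exchange (g zero) (h zero) (sumFin (g ∘ suc)) (sumFin (h ∘ suc)) ⟩
  g zero + sumFin (g ∘ suc) + (h zero + sumFin (h ∘ suc)) ∎
  where
  open ≡-Reasoning
  +-exchange : ∀ a b c d → a + b + (c + d) ≡ a + c + (b + d)
  +-exchange = solve-∀

sum-map-≤-* : (f : A → ℕ) (xs : List A) {c : ℕ} → (∀ {x} → x ∈ xs → f x ≤ c) →
              sum (map f xs) ≤ length xs * c
sum-map-≤-* f [] f≤c = z≤n
sum-map-≤-* f (x ∷ xs) f≤c = +-mono-≤ (f≤c (here refl)) (sum-map-≤-* f xs (f≤c ∘ there))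

module _ {P : Pred A 0ℓ} (P? : Decidable P) where

  sum-map-if : (p : ℕ) (xs : List A) →
    length (filter P? xs) * p + (length xs ∸ length (filter P? xs))
      ≡ sum (map (λ x → if does (P? x) then p else 1) xs)
  sum-map-if p [] = refl
  sum-map-if p (x ∷ xs) with P? x
  ... | yes _ = trans (+-assoc p _ _) (cong (p +_) (sum-map-if p xs))
  ... | no _ = begin
    length (filter P? xs) * p + (suc (length xs) ∸ length (filter P? xs))
      ≡⟨ cong (length (filter P? xs) * p +_) (+-∸-assoc 1 (length-filter P? xs)) ⟩
    length (filter P? xs) * p + suc (length xs ∸ length (filter P? xs))
      ≡⟨ +-suc _ _ ⟩
    suc (length (filter P? xs) * p + (length xs ∸ length (filter P? xs)))
      ≡⟨ cong suc (sum-map-if p xs) ⟩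
    suc (sum (map (λ x → if does (P? x) then p else 1) xs)) ∎
    where open ≡-Reasoning

module _ {b : ℕ} {B : Fin b → Pred A 0ℓ} (B? : ∀ l → Decidable (B l)) (w : A → ℕ) where

  private
    sum-filter : Fin b → List A → ℕ
    sum-filter l xs = sum (map w (filter (B? l) xs))

    sum-filter-∷ : ∀ l x xs →
      sum-filter l (x ∷ xs) ≡ (if does (B? l x) then w x else 0) + sum-filter l xs
    sum-filter-∷ l x xs with B? l x
    ... | yes _ = refl
    ... | no _ = refl

  sum-map-≤-sumFin-filter : (xs : List A) → (∀ {x} → x ∈ xs → ∃ λ l → B l x) →
                            sum (map w xs) ≤ sumFin (λ l → sum (map w (filter (B? l) xs)))
  sum-map-≤-sumFin-filter [] _ = z≤n
  sum-map-≤-sumFin-filter (x ∷ xs) covered = begin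
    w x + sum (map w xs)
      ≤⟨ +-mono-≤ wx≤ (sum-map-≤-sumFin-filter xs (covered ∘ there)) ⟩
    sumFin (λ l → if does (B? l x) then w x else 0) + sumFin (λ l → sum-filter l xs)
      ≡⟨ sumFin-+ (λ l → if does (B? l x) then w x else 0) (λ l → sum-filter l xs) ⟨
    sumFin (λ l → (if does (B? l x) then w x else 0) + sum-filter l xs)
      ≡⟨ sumFin-cong (λ l → sum-filter-∷ l x xs) ⟨
    sumFin (λ l → sum-filter l (x ∷ xs)) ∎
    where
    open ≤-Reasoning
    wx≤ : w x ≤ sumFin (λ l → if does (B? l x) then w x else 0)
    wx≤ with covered (here refl)
    ... | l , Blx = ≤-trans (≤-reflexive (cong (if_then w x else 0) (sym (dec-true (B? l x) Blx))))
                            (≤-sumFin (λ l → if does (B? l x) then w x else 0) l)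

module _ {V : Set} (adjacent : Adjacency V) where

  LColoring-mono : {Λ Λ′ : V → List ℕ} → (∀ v → Λ v ⊆ Λ′ v) →
                   LColoring adjacent Λ → LColoring adjacent Λ′
  LColoring-mono Λ⊆Λ′ (f , f∈Λ , proper) = f , (λ v → Λ⊆Λ′ v (f∈Λ v)) , proper

  Proper-≗ : {f g : V → ℕ} → f ≗ g → Proper adjacent f → Proper adjacent g
  Proper-≗ f≗g proper u v u~v gu≡gv = proper u v u~v (trans (f≗g u) (trans gu≡gv (sym (f≗g v))))

Proper? : ∀ {n} (adjacent : Adjacency (Fin n)) (f : Fin n → ℕ) → Dec (Proper adjacent f)
Proper? adjacent f =
  all? λ u → all? λ v → (adjacent u v Bool.≟ true) →-dec ¬? (f u ℕ.≟ f v)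

LColoring? : ∀ {n} (adjacent : Adjacency (Fin n)) (Λ : Fin n → List ℕ) → Dec (LColoring adjacent Λ)
LColoring? {n} adjacent Λ with any? (Proper? adjacent ∘ lookup) (choices n Λ)
... | yes found = let (v , v∈ , proper) = find found in yes (lookup v , ∈-choices⁻ n Λ v∈ , proper)
... | no none = no λ { (f , f∈Λ , proper) →
  none (lose (∈-choices⁺ n Λ (Data.Vec.tabulate f)
                (λ j → subst (_∈ Λ j) (sym (Vec.lookup∘tabulate f j)) (f∈Λ j)))
             (Proper-≗ adjacent (sym ∘ Vec.lookup∘tabulate f) proper)) }

module _ {V W : Set} (_≟V_ : DecidableEquality V) (_≟W_ : DecidableEquality W)
         (adjG : Adjacency V) (adjH : Adjacency W) where

  cartAdj-edge : ∀ {u v u′ v′} → cartAdj _≟V_ _≟W_ adjG adjH (u , v) (u′ , v′) ≡ true →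
                 (u ≡ u′ × adjH v v′ ≡ true) ⊎ (v ≡ v′ × adjG u u′ ≡ true)
  cartAdj-edge {u} {v} {u′} {v′} edge
    with Equivalence.to (T-∨ {⌊ u ≟V u′ ⌋ ∧ adjH v v′}) (Equivalence.from T-≡ edge)
  ... | inj₁ t = let (u≡u′ , v~v′) = Equivalence.to (T-∧ {⌊ u ≟V u′ ⌋}) t
                 in inj₁ (toWitness u≡u′ , Equivalence.to T-≡ v~v′)
  ... | inj₂ t = let (v≡v′ , u~u′) = Equivalence.to (T-∧ {⌊ v ≟W v′ ⌋}) t
                 in inj₂ (toWitness v≡v′ , Equivalence.to T-≡ u~u′)

another-vertex : ∀ {n m} (M : Graph n) → ¬ Colorable (adj M) (suc m) → (i : Fin n) → ∃ λ u → u ≢ i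
another-vertex {suc zero} M uncolorable zero = ⊥-elim (uncolorable ((λ _ → zero) , constant-proper))
  where
  constant-proper : Proper (adj M) (λ _ → zero)
  constant-proper zero zero loop _ = contradiction (trans (sym loop) (adj-irrefl M zero)) λ ()
another-vertex {suc (suc n)} M _ zero = suc zero , λ ()
another-vertex {suc (suc n)} M _ (suc i) = zero , λ ()

updateAt-pointwise : ∀ {n} (R : Fin n → A → Set) (xs : Vector A n) (i : Fin n) {x : A} →
  R i x → (∀ v → R v (xs v)) → ∀ v → R v (updateAt xs i (const x) v)
updateAt-pointwise R xs i Rix Rxs v with v Fin.≟ i
... | yes refl = subst (R i) (sym (updateAt-updates i xs)) Rix
... | no v≢i = subst (R v) (sym (updateAt-minimal v i xs v≢i)) (Rxs v)

module _ {n m : ℕ} (M : Graph n) (scc : StronglyChromaticChoosable M (suc (suc m)))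
         {Λ : Fin n → List ℕ} (Λ! : ∀ i → Unique (Λ i)) (Λ-long : ∀ i → suc m ≤ length (Λ i))
         (Λ-uncolorable : ¬ LColoring (adj M) Λ) where

  private
    take⊆ : ∀ k (xs : List ℕ) → take k xs ⊆ xs
    take⊆ k xs = Sublist.Any-resp-⊆ (Sublist.take-⊆ k xs)

    length-take≡ : ∀ k (xs : List ℕ) → k ≤ length xs → length (take k xs) ≡ k
    length-take≡ k xs k≤ = trans (length-take k xs) (m≤n⇒m⊓n≡m k≤)

    truncation : Fin n → List ℕ
    truncation u = take (suc m) (Λ u)

    sublist≈truncation : ∀ {i u} (s : List ℕ) → u ≢ i → length s ≡ suc m → Unique s → s ⊆ Λ i →
                         SameList s (truncation u)
    sublist≈truncation {i} {u} s u≢i s-length s! s⊆Λi =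
      subst₂ SameList (updateAt-updates i truncation) (updateAt-minimal u i truncation u≢i)
             (proj₂ scc Λ′ Λ′-assignment (Λ-uncolorable ∘ LColoring-mono (adj M) Λ′⊆Λ) i u)
      where
      Λ′ : Fin n → List ℕ
      Λ′ = updateAt truncation i (const s)
      Λ′-assignment : IsAssignment Λ′ (suc m)
      Λ′-assignment = updateAt-pointwise (λ _ xs → length xs ≡ suc m × Unique xs) truncation i
        (s-length , s!) (λ v → length-take≡ (suc m) (Λ v) (Λ-long v) , Unique.take⁺ (suc m) (Λ! v))
      Λ′⊆Λ : ∀ v → Λ′ v ⊆ Λ v
      Λ′⊆Λ = updateAt-pointwise (λ v xs → xs ⊆ Λ v) truncation i s⊆Λi (λ v → take⊆ (suc m) (Λ v))

    -- If Λ i = x ∷ ys were longer, its sublists x ∷ take m ys and take (suc m) ys would both have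
    -- the colours of the truncated list at another vertex, but only the first contains x.
    tail-short : ∀ {i x ys} → Λ i ≡ x ∷ ys → ¬ (suc m ≤ length ys)
    tail-short {i} {x} {ys} Λi≡x∷ys long =
      x∉ys (take⊆ (suc m) ys (proj₂ (s₂≈T x) (proj₁ (s₁≈T x) (here refl))))
      where
      u : Fin n
      u = proj₁ (another-vertex M (proj₂ (proj₁ (proj₁ scc))) i)
      u≢i : u ≢ i
      u≢i = proj₂ (another-vertex M (proj₂ (proj₁ (proj₁ scc))) i)
      x∷ys! : Unique (x ∷ ys)
      x∷ys! = subst Unique Λi≡x∷ys (Λ! i)
      x≢ys : All.All (x ≢_) ys
      x≢ys = AllPairs.head x∷ys!
      x∉ys : x ∉ ys
      x∉ys x∈ys = All.lookup x≢ys x∈ys refl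
      ys! : Unique ys
      ys! = AllPairs.tail x∷ys!
      ⊆Λi : ∀ {s} → s ⊆ x ∷ ys → s ⊆ Λ i
      ⊆Λi s⊆ = subst (_ ⊆_) (sym Λi≡x∷ys) s⊆
      s₁≈T : SameList (x ∷ take m ys) (truncation u)
      s₁≈T = sublist≈truncation (x ∷ take m ys) u≢i
        (cong suc (length-take≡ m ys (≤-trans (n≤1+n m) long)))
        (All.tabulate (λ p → All.lookup x≢ys (take⊆ m ys p)) ∷ Unique.take⁺ m ys!)
        (⊆Λi λ { (here refl) → here refl ; (there p) → there (take⊆ m ys p) })
      s₂≈T : SameList (take (suc m) ys) (truncation u)
      s₂≈T = sublist≈truncation (take (suc m) ys) u≢i (length-take≡ (suc m) ys long)
        (Unique.take⁺ (suc m) ys!) (⊆Λi (there ∘ take⊆ (suc m) ys))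

  uncolorable⇒length≡ : ∀ i → length (Λ i) ≡ suc m
  uncolorable⇒length≡ i = ≤-antisym (length≤ (Λ i) refl) (Λ-long i)
    where
    length≤ : ∀ xs → Λ i ≡ xs → length xs ≤ suc m
    length≤ [] _ = z≤n
    length≤ (x ∷ ys) Λi≡x∷ys = s≤s (≮⇒≥ (tail-short Λi≡x∷ys))

  uncolorable⇒sameList : ∀ u v → SameList (Λ u) (Λ v)
  uncolorable⇒sameList = proj₂ scc Λ (λ i → uncolorable⇒length≡ i , Λ! i) Λ-uncolorable

-- ToOne counts with ⌊_⌋ = isYes, to which dec-true (about does) does not apply.
isYes-true : {P : Set} (d : Dec P) → P → ⌊ d ⌋ ≡ true
isYes-true (yes _) _ = refl
isYes-true (no ¬p) p = contradiction p ¬p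

every-row-hit⇒¬ToOne : ∀ {n a} (F : Fin (suc n) × Fin a → ℕ) (c : ℕ) →
                       (∀ i → ∃ λ j → F (i , j) ≡ c) → ¬ ToOne {suc n} {a} F
every-row-hit⇒¬ToOne {n} F c hit toOne =
  n≮n n (begin-strict
    n                     <⟨ n<1+n n ⟩
    suc n                 ≡⟨ *-identityʳ (suc n) ⟨
    suc n * 1             ≤⟨ *-≤-sumFin _ row-hit ⟩
    fiberSize F c         ≤⟨ toOne c ((zero , proj₁ (hit zero)) , proj₂ (hit zero)) ⟩
    n                     ∎)
  where
  open ≤-Reasoning
  indicator : Fin _ → Fin _ → ℕ
  indicator i j = if ⌊ F (i , j) ℕ.≟ c ⌋ then 1 else 0
  row-hit : ∀ i → 1 ≤ sumFin (indicator i)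
  row-hit i with hit i
  ... | j , Fij≡c =
    ≤-trans (≤-reflexive (cong (if_then 1 else 0) (sym (isYes-true (F (i , j) ℕ.≟ c) Fij≡c))))
            (≤-sumFin (indicator i) j)

lookup-≗⇒≡ : ∀ {n} {u v : Vec A n} → lookup u ≗ lookup v → u ≡ v
lookup-≗⇒≡ {u = u} {v} u≗v =
  trans (sym (Vec.tabulate∘lookup u)) (trans (Vec.tabulate-cong u≗v) (Vec.tabulate∘lookup v))

asFun-injective : ∀ {n a} {g h : Vec (Vec ℕ a) n} →
                  (∀ i j → asFun g (i , j) ≡ asFun h (i , j)) → g ≡ h
asFun-injective g≗h = lookup-≗⇒≡ (λ i → lookup-≗⇒≡ (g≗h i))

module _ {m n a b : ℕ} (M : Graph (suc n)) (scc : StronglyChromaticChoosable M (suc (suc m)))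
         (L : Fin (suc n) × (Fin a ⊎ Fin b) → List ℕ) (L-assignment : IsAssignment L (suc m + a))
         (X-disjoint : ∀ i j j′ → j ≢ j′ → ∀ c → c ∈ L (i , inj₁ j) → c ∉ L (i , inj₁ j′)) where

  open import Data.List.Membership.DecPropositional ℕ._≟_ using (_∈?_; _∉?_)

  XColoring : Set
  XColoring = Fin (suc n) × Fin a → ℕ

  FromLX : XColoring → Set
  FromLX F = ∀ i j → F (i , j) ∈ L (i , inj₁ j)

  row : XColoring → Fin (suc n) → List ℕ
  row F i = tabulate (λ j → F (i , j))

  LY : Fin b → Fin (suc n) → List ℕ
  LY l i = L (i , inj₂ l)

  residual : XColoring → Fin b → Fin (suc n) → List ℕ
  residual F l i = filter (_∉? row F i) (LY l i)

  Blocked : XColoring → Fin b → Set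
  Blocked F l = ¬ LColoring (adj M) (residual F l)

  ∈-residual⁺ : ∀ F {l i c} → c ∈ LY l i → c ∉ row F i → c ∈ residual F l i
  ∈-residual⁺ F {i = i} = ∈-filter⁺ (_∉? row F i)

  ∈-residual⁻ : ∀ F {l i c} → c ∈ residual F l i → c ∈ LY l i × c ∉ row F i
  ∈-residual⁻ F {l} {i} = ∈-filter⁻ (_∉? row F i) {xs = LY l i}

  length-row : ∀ F i → length (row F i) ≡ a
  length-row F i = length-tabulate (λ j → F (i , j))

  length-residual : ∀ F l i →
    length (filter (_∈? row F i) (LY l i)) + length (residual F l i) ≡ suc m + a
  length-residual F l i =
    trans (length-filter-∁ (_∈? row F i) (LY l i)) (proj₁ (L-assignment (i , inj₂ l)))

  residual-long : ∀ F l i → suc m ≤ length (residual F l i)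
  residual-long F l i = +-cancelʳ-≤ a (suc m) _ (begin
    suc m + a                                     ≡⟨ length-residual F l i ⟨
    length (filter (_∈? row F i) (LY l i)) + length (residual F l i)
      ≤⟨ +-monoˡ-≤ _ (length-filter-∈≤ ℕ._≟_ (row F i) (proj₂ (L-assignment (i , inj₂ l)))) ⟩
    length (row F i) + length (residual F l i)
      ≡⟨ cong (_+ length (residual F l i)) (length-row F i) ⟩
    a + length (residual F l i)                   ≡⟨ +-comm a _ ⟩
    length (residual F l i) + a                   ∎)
    where open ≤-Reasoning

  module _ {F : XColoring} {l : Fin b} (blocked : Blocked F l) where

    private
      residual! : ∀ i → Unique (residual F l i)
      residual! i = Unique.filter⁺ (_∉? row F i) (proj₂ (L-assignment (i , inj₂ l)))

    blocked-length≡ : ∀ i → length (residual F l i) ≡ suc m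
    blocked-length≡ = uncolorable⇒length≡ M scc residual! (residual-long F l) blocked

    blocked-transfer : ∀ {u v c} → c ∈ residual F l u → c ∈ residual F l v
    blocked-transfer {u} {v} {c} =
      proj₁ (uncolorable⇒sameList M scc residual! (residual-long F l) blocked u v c)

    blocked-row⊆ : ∀ i → row F i ⊆ LY l i
    blocked-row⊆ i {c} c∈row with c ∈? LY l i
    ... | yes c∈Y = c∈Y
    ... | no c∉Y = ⊥-elim (<-irrefl refl (begin-strict
      suc m + a                                     ≡⟨ length-residual F l i ⟨
      length (filter (_∈? row F i) (LY l i)) + length (residual F l i)
        <⟨ +-monoˡ-< _ (length-filter-∈< ℕ._≟_ (proj₂ (L-assignment (i , inj₂ l))) c∈row c∉Y) ⟩
      length (row F i) + length (residual F l i)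
        ≡⟨ cong₂ _+_ (length-row F i) (blocked-length≡ i) ⟩
      a + suc m                                     ≡⟨ +-comm a (suc m) ⟩
      suc m + a                                     ∎))
      where open ≤-Reasoning

  blocked-determined : ∀ {F F′ l} → Blocked F l → Blocked F′ l → FromLX F → FromLX F′ →
    (v : Fin (suc n)) → residual F′ l v ⊆ residual F l v → ∀ i j → F (i , j) ≡ F′ (i , j)
  blocked-determined {F} {F′} {l} blocked blocked′ F∈L F′∈L v residual⊆ i j
    with F (i , j) ∈? row F′ i
  ... | no c∉row′ = ⊥-elim (proj₂ (∈-residual⁻ F c∈residual) (∈-tabulate⁺ j))
    where
    c∈residual : F (i , j) ∈ residual F l i
    c∈residual = blocked-transfer blocked (residual⊆ (blocked-transfer blocked′
                   (∈-residual⁺ F′ (blocked-row⊆ blocked i (∈-tabulate⁺ j)) c∉row′)))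
  ... | yes c∈row′ with ∈-tabulate⁻ c∈row′
  ... | j′ , Fij≡F′ij′ with j Fin.≟ j′
  ...   | yes refl = Fij≡F′ij′
  ...   | no j≢j′ = ⊥-elim (X-disjoint i j j′ j≢j′ _ (F∈L i j)
                              (subst (_∈ L (i , inj₁ j′)) (sym Fij≡F′ij′) (F′∈L i j′)))

  blocked-determined-by-row : ∀ {F F′ l} → Blocked F l → Blocked F′ l → FromLX F → FromLX F′ →
    (v : Fin (suc n)) → (∀ j → F (v , j) ≡ F′ (v , j)) → ∀ i j → F (i , j) ≡ F′ (i , j)
  blocked-determined-by-row {F} {F′} {l} blocked blocked′ F∈L F′∈L v same-row =
    blocked-determined blocked blocked′ F∈L F′∈L v (subst (_ ∈_) residual≡)
    where
    residual≡ : residual F′ l v ≡ residual F l v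
    residual≡ = cong (λ r → filter (_∉? r) (LY l v)) (tabulate-cong (sym ∘ same-row))

  toOne-residual⊇ : ∀ {F F′ l} → Blocked F l → Blocked F′ l → ToOne {suc n} {a} F →
    (v : Fin (suc n)) → residual F′ l v ⊆ residual F l v
  toOne-residual⊇ {F} {F′} {l} blocked blocked′ toOne v {c} c∈residual′ with c ∈? residual F l v
  ... | yes c∈residual = c∈residual
  ... | no c∉residual = ⊥-elim (every-row-hit⇒¬ToOne F c in-every-row toOne)
    where
    in-every-row : ∀ i → ∃ λ j → F (i , j) ≡ c
    in-every-row i with c ∈? row F i
    ... | yes c∈row = let (j , c≡Fij) = ∈-tabulate⁻ c∈row in j , sym c≡Fij
    ... | no c∉row = ⊥-elim (c∉residual (blocked-transfer blocked
          (∈-residual⁺ F (proj₁ (∈-residual⁻ F′ (blocked-transfer blocked′ c∈residual′))) c∉row)))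

  candidates : Fin b → Fin a → List ℕ
  candidates l j = filter (_∈? LY l zero) (L (zero , inj₁ j))

  blocked-row∈candidates : ∀ {F l} → Blocked F l → FromLX F → ∀ j → F (zero , j) ∈ candidates l j
  blocked-row∈candidates {F} {l} blocked F∈L j =
    ∈-filter⁺ (_∈? LY l zero) (F∈L zero j) (blocked-row⊆ blocked zero (∈-tabulate⁺ j))

  length-choices-candidates : ∀ l → length (choices a (candidates l)) ≤ 2 ^ suc m
  length-choices-candidates l = *-cancelʳ-≤ _ _ (2 ^ a) {{m^n≢0 2 a}} (begin
    length (choices a (candidates l)) * 2 ^ a
      ≤⟨ length-choices-disjoint ℕ._≟_ a (candidates l) (LY l zero)
           (λ j → Unique.filter⁺ (_∈? LY l zero) (proj₂ (L-assignment (zero , inj₁ j))))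
           (λ j → proj₂ ∘ ∈-filter⁻ (_∈? LY l zero) {xs = L (zero , inj₁ j)})
           candidates-disjoint ⟩
    2 ^ length (LY l zero)   ≡⟨ cong (2 ^_) (proj₁ (L-assignment (zero , inj₂ l))) ⟩
    2 ^ (suc m + a)          ≡⟨ ^-distribˡ-+-* 2 (suc m) a ⟩
    2 ^ suc m * 2 ^ a        ∎)
    where
    open ≤-Reasoning
    candidates-disjoint : ∀ {j j′} → j ≢ j′ → Disjoint (candidates l j) (candidates l j′)
    candidates-disjoint {j} {j′} j≢j′ (c∈ , c∈′) = X-disjoint zero j j′ j≢j′ _
      (proj₁ (∈-filter⁻ (_∈? LY l zero) {xs = L (zero , inj₁ j)} c∈))
      (proj₁ (∈-filter⁻ (_∈? LY l zero) {xs = L (zero , inj₁ j′)} c∈′))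

  XTable : Set
  XTable = Vec (Vec ℕ a) (suc n)

  ∈-CX⁻ : ∀ {g} → g ∈ CX M a b L → FromLX (asFun g) × Proper (HXAdj M a b) (asFun g)
  ∈-CX⁻ g∈ with ∈-filter⁻ (proper? (HXAdj M a b) ∘ asFun)
                          {xs = allLXColorings (suc n) a (LX {b = b} L)} g∈
  ... | g∈choices , proper =
    (λ i j → ∈-choices⁻ a (λ j → L (i , inj₁ j))
               (∈-choices⁻ (suc n) (λ i → choices a (λ j → L (i , inj₁ j))) g∈choices i) j) ,
    proper

  CX-unique : Unique (CX M a b L)
  CX-unique = Unique.filter⁺ (proper? (HXAdj M a b) ∘ asFun) (choices-unique (suc n) _
    (λ i → choices-unique a _ (λ j → proj₂ (L-assignment (i , inj₁ j)))))

  Blocked? : ∀ l (g : XTable) → Dec (Blocked (asFun g) l)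
  Blocked? l g = ¬? (LColoring? (adj M) (residual (asFun g) l))

  blockedAt : Fin b → List XTable
  blockedAt l = filter (Blocked? l) (CX M a b L)

  ∈-blockedAt⁻ : ∀ {l g} → g ∈ blockedAt l → Blocked (asFun g) l × FromLX (asFun g)
  ∈-blockedAt⁻ {l} g∈ with ∈-filter⁻ (Blocked? l) {xs = CX M a b L} g∈
  ... | g∈CX , blocked = blocked , proj₁ (∈-CX⁻ g∈CX)

  blockedAt! : ∀ l → Unique (blockedAt l)
  blockedAt! l = Unique.filter⁺ (Blocked? l) CX-unique

  toOne-blockedAt⊆ : ∀ {l g₀} → g₀ ∈ blockedAt l → ToOne {suc n} {a} (asFun g₀) →
                     blockedAt l ⊆ g₀ ∷ []
  toOne-blockedAt⊆ g₀∈ g₀-toOne g∈ =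
    let (blocked₀ , F₀∈L) = ∈-blockedAt⁻ g₀∈ ; (blocked , F∈L) = ∈-blockedAt⁻ g∈ in
    here (sym (asFun-injective (blocked-determined blocked₀ blocked F₀∈L F∈L zero
                                  (toOne-residual⊇ blocked₀ blocked g₀-toOne zero))))

  length-blockedAt : ∀ l → length (blockedAt l) ≤ 2 ^ suc m
  length-blockedAt l = ≤-trans
    (injectiveOn⇒length≤ (λ g → lookup g zero) (blockedAt! l) first-row∈ first-row-injective)
    (length-choices-candidates l)
    where
    first-row∈ : ∀ {g} → g ∈ blockedAt l → lookup g zero ∈ choices a (candidates l)
    first-row∈ g∈ = let (blocked , F∈L) = ∈-blockedAt⁻ g∈ in
      ∈-choices⁺ a (candidates l) _ (blocked-row∈candidates blocked F∈L)
    first-row-injective : ∀ {g g′} → g ∈ blockedAt l → g′ ∈ blockedAt l →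
                          lookup g zero ≡ lookup g′ zero → g ≡ g′
    first-row-injective g∈ g′∈ same-row =
      let (blocked , F∈L) = ∈-blockedAt⁻ g∈ ; (blocked′ , F′∈L) = ∈-blockedAt⁻ g′∈ in
      asFun-injective (blocked-determined-by-row blocked blocked′ F∈L F′∈L zero
                                                 (λ j → cong (λ r → lookup r j) same-row))

  weight : XTable → ℕ
  weight g = if does (toOne? (asFun g)) then 2 ^ suc m else 1

  weight≤ : ∀ g → weight g ≤ 2 ^ suc m
  weight≤ g with does (toOne? (asFun g))
  ... | true = ≤-refl
  ... | false = m^n>0 2 (suc m)

  sum-weight-blockedAt : ∀ l → sum (map weight (blockedAt l)) ≤ 2 ^ suc m
  sum-weight-blockedAt l with any? (toOne? ∘ asFun) (blockedAt l)
  ... | yes has-toOne with find has-toOne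
  ...   | g₀ , g₀∈ , g₀-toOne = begin
    sum (map weight (blockedAt l))       ≤⟨ sum-map-≤-* weight (blockedAt l) (λ {g} _ → weight≤ g) ⟩
    length (blockedAt l) * 2 ^ suc m
      ≤⟨ *-monoˡ-≤ (2 ^ suc m) (⊆⇒length≤ (blockedAt! l) (toOne-blockedAt⊆ g₀∈ g₀-toOne)) ⟩
    1 * 2 ^ suc m                        ≡⟨ *-identityˡ (2 ^ suc m) ⟩
    2 ^ suc m                            ∎
    where open ≤-Reasoning
  sum-weight-blockedAt l | no no-toOne = begin
    sum (map weight (blockedAt l))       ≤⟨ sum-map-≤-* weight (blockedAt l) weight≤1 ⟩
    length (blockedAt l) * 1             ≡⟨ *-identityʳ _ ⟩
    length (blockedAt l)                 ≤⟨ length-blockedAt l ⟩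
    2 ^ suc m                            ∎
    where
    open ≤-Reasoning
    weight≤1 : ∀ {g} → g ∈ blockedAt l → weight g ≤ 1
    weight≤1 {g} g∈ = ≤-reflexive (cong (if_then 2 ^ suc m else 1)
                        (dec-false (toOne? (asFun g)) (no-toOne ∘ lose g∈)))

  extend : (F : XColoring) → FromLX F → Proper (HXAdj M a b) F →
           (∀ l → LColoring (adj M) (residual F l)) → LColoring (HAdj M a b) L
  extend F F∈L F-proper colour-Y = h , h∈L , h-proper
    where
    h : Fin (suc n) × (Fin a ⊎ Fin b) → ℕ
    h (i , inj₁ j) = F (i , j)
    h (i , inj₂ l) = proj₁ (colour-Y l) i
    h∈residual : ∀ l i → h (i , inj₂ l) ∈ residual F l i
    h∈residual l i = proj₁ (proj₂ (colour-Y l)) i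
    h∈L : ∀ v → h v ∈ L v
    h∈L (i , inj₁ j) = F∈L i j
    h∈L (i , inj₂ l) = proj₁ (∈-residual⁻ F (h∈residual l i))
    x≢y : ∀ i j l → F (i , j) ≢ h (i , inj₂ l)
    x≢y i j l Fij≡ =
      proj₂ (∈-residual⁻ F (h∈residual l i)) (subst (_∈ row F i) Fij≡ (∈-tabulate⁺ j))
    edge : ∀ {i i′ x y} → HAdj M a b (i , x) (i′ , y) ≡ true →
           (i ≡ i′ × KAdj a b x y ≡ true) ⊎ (x ≡ y × adj M i i′ ≡ true)
    edge = cartAdj-edge Fin._≟_ (Sum.≡-dec Fin._≟_ Fin._≟_) (adj M) (KAdj a b)
    h-proper : Proper (HAdj M a b) h
    h-proper (i , inj₁ j) (i′ , inj₁ j′) i~i′ = F-proper (i , j) (i′ , j′) i~i′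
    h-proper (i , inj₁ j) (i′ , inj₂ l) e with edge {i} {i′} {inj₁ j} {inj₂ l} e
    ... | inj₁ (refl , _) = x≢y i j l
    h-proper (i , inj₂ l) (i′ , inj₁ j) e with edge {i} {i′} {inj₂ l} {inj₁ j} e
    ... | inj₁ (refl , _) = x≢y i j l ∘ sym
    h-proper (i , inj₂ l) (i′ , inj₂ l′) e with edge {i} {i′} {inj₂ l} {inj₂ l′} e
    ... | inj₂ (refl , i~i′) = proj₂ (proj₂ (colour-Y l)) i i′ i~i′

  LColoring-from-count :
    b * 2 ^ suc m < length (IX M a b L) * 2 ^ suc m + (length (CX M a b L) ∸ length (IX M a b L)) →
    LColoring (HAdj M a b) L
  LColoring-from-count count
    with any? (λ g → all? λ l → LColoring? (adj M) (residual (asFun g) l)) (CX M a b L)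
  ... | yes extendable =
    let (g , g∈ , colour-Y) = find extendable ; (F∈L , F-proper) = ∈-CX⁻ g∈ in
    extend (asFun g) F∈L F-proper colour-Y
  ... | no ¬extendable = contradiction count (≤⇒≯ (begin
    length (IX M a b L) * 2 ^ suc m + (length (CX M a b L) ∸ length (IX M a b L))
      ≡⟨ sum-map-if (toOne? ∘ asFun) (2 ^ suc m) (CX M a b L) ⟩
    sum (map weight (CX M a b L))
      ≤⟨ sum-map-≤-sumFin-filter Blocked? weight (CX M a b L) blocked-somewhere ⟩
    sumFin (λ l → sum (map weight (blockedAt l)))
      ≤⟨ sumFin-≤-* _ sum-weight-blockedAt ⟩
    b * 2 ^ suc m ∎))
    where
    open ≤-Reasoning
    blocked-somewhere : ∀ {g} → g ∈ CX M a b L → ∃ λ l → Blocked (asFun g) l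
    blocked-somewhere {g} g∈ =
      ¬∀⟶∃¬ b _ (λ l → LColoring? (adj M) (residual (asFun g) l)) (¬extendable ∘ lose g∈)

lemma14 : (k a b n : ℕ) → 2 ≤ k → 1 ≤ a → 1 ≤ b →
    (M : Graph n) → StronglyChromaticChoosable M k →
    (L : Fin n × (Fin a ⊎ Fin b) → List ℕ) → IsAssignment L (k + a ∸ 1) →
    (∀ i j j' → j ≢ j' → ∀ c → c ∈ L (i , inj₁ j) → c ∉ L (i , inj₁ j')) →
    b * 2 ^ (k ∸ 1) < length (IX M a b L) * 2 ^ (k ∸ 1) + (length (CX M a b L) ∸ length (IX M a b L)) →
    LColoring (HAdj M a b) L
lemma14 (suc (suc m)) a b (suc n) _ _ _ M scc L L-assignment X-disjoint count =
  LColoring-from-count M scc L L-assignment X-disjoint count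
lemma14 (suc (suc m)) a b zero _ _ _ M scc _ _ _ _ =
  ⊥-elim (proj₂ (proj₁ (proj₁ scc)) ((λ ()) , (λ ())))
lemma14 (suc zero) _ _ _ (s≤s ()) _ _ _ _ _ _ _ _
lemma14 zero _ _ _ () _ _ _ _ _ _ _ _
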